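{- Let $t$ be a term and $\sigma$ a substitution. Then $\langle t,\sigma\rangle$ is a pattern term if and only if some cycle of the variable transition graph $G_{\sigma,t}$ contains a variable $x$ such that $x\sigma\notin\mathcal{V}$.
   Context: Terms are built over a finite signature and an infinite set of variables $\mathcal{V}$; a substitution $\sigma$ maps variables to terms, has finite domain $\{x\mid x\sigma\neq x\}$, and is extended homomorphically to terms; $\sigma^m$ denotes $m$-fold application ($t\sigma^0=t$); $\mathcal{V}(s)$ is the set of variables occurring in $s$. A pair $\langle t,\sigma\rangle$ is a pattern term if $t\sigma^m\neq t\sigma^{m'}$ for all natural numbers $m\neq m'$. $G_\sigma$ is the directed graph whose nodes are all variables, with an edge from $x$ to $y$ iff $y\in\mathcal{V}(x\sigma)$. The variable transition graph $G_{\sigma,t}$ of $\sigma$ w.r.t. $t$ is the subgraph of $G_\sigma$ consisting of those nodes reachable from a node in $\mathcal{V}(t)$ (with the edges of $G_\sigma$ between them). -}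

module Defs where

open import Data.Nat using (ℕ; zero; suc; _≥_)
open import Data.Fin using (Fin)
open import Data.Vec using (Vec; []; _∷_)
open import Data.Vec.Membership.Propositional using () renaming (_∈_ to _∈ᵥ_)
open import Data.Product using (Σ; ∃; _×_; _,_)
open import Relation.Binary.PropositionalEquality using (_≡_)
open import Relation.Binary.Construct.Closure.ReflexiveTransitive using (Star)
open import Relation.Binary.Construct.Closure.Transitive using (TransClosure)

record Signature : Set where
  field
    size  : ℕ
    arity : Fin size → ℕ

Var : Set
Var = ℕ

module _ (Σs : Signature) where
  open Signature Σs

  data Term : Set where
    var : Var → Term
    fun : (f : Fin size) → Vec Term (arity f) → Term

  data _∈V_ (x : Var) : Term → Set where
    here : x ∈V var x
    arg  : ∀ {f ts s} → s ∈ᵥ ts → x ∈V s → x ∈V fun f ts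

  record Subst : Set where
    field
      map    : Var → Term
      finite : Σ ℕ λ N → ∀ x → x ≥ N → map x ≡ var x
  open Subst public

  mutual
    _·_ : Term → Subst → Term
    var x    · σ = map σ x
    fun f ts · σ = fun f (applyVec ts σ)

    applyVec : ∀ {n} → Vec Term n → Subst → Vec Term n
    applyVec []       σ = []
    applyVec (t ∷ ts) σ = (t · σ) ∷ applyVec ts σ

  _·_^_ : Term → Subst → ℕ → Term
  t · σ ^ zero  = t
  t · σ ^ suc m = (t · σ ^ m) · σ

  IsPatternTerm : Term → Subst → Set
  IsPatternTerm t σ = ∀ m m' → m ≢ m' → (t · σ ^ m) ≢ (t · σ ^ m')
    where
    open import Relation.Binary.PropositionalEquality using (_≢_)

  Edge : Subst → Var → Var → Set
  Edge σ x y = y ∈V map σ x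

  InG : Subst → Term → Var → Set
  InG σ t x = ∃ λ z → z ∈V t × Star (Edge σ) z x

  EdgeG : Subst → Term → Var → Var → Set
  EdgeG σ t x y = InG σ t x × InG σ t y × Edge σ x y

  OnCycle : Subst → Term → Var → Set
  OnCycle σ t x = TransClosure (EdgeG σ t) x x

  NotVar : Term → Set
  NotVar s = ∀ y → s ≢ var y
    where
    open import Relation.Binary.PropositionalEquality using (_≢_)

-- If x lies on a cycle of G_{σ,t} and xσ is not a variable, then x is a proper subterm of
-- xσ^L for some L ≥ 1, so the depths of the terms tσ^m are unbounded; but t σ^m = t σ^m' with
-- m < m' would make the orbit of t finite.
-- Conversely, every xσ^m with x in G_{σ,t} is assembled from the images of the finitely many
-- variables whose image is not a variable ("growing" variables). Unless some walk from t passes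
-- more growing variables than there are, so that one of them repeats and lies on a cycle, all
-- t σ^m lie in one finite list of terms, and by pigeonhole two of them coincide.
module Submission where

open import Defs
import Level
open import Data.Nat using (ℕ; zero; suc; _+_; _*_; _≤_; _<_; _≮_; z≤n; s≤s; s≤s⁻¹; s<s⁻¹; _⊔_; _<?_)
open import Data.Nat.Properties
open import Data.Fin using (Fin; toℕ)
open import Data.Fin.Properties using (pigeonhole; toℕ<n)
open import Data.Product using (∃; ∃₂; _×_; _,_; proj₁; proj₂)
open import Data.Sum using (_⊎_; inj₁; inj₂; [_,_]) renaming (map to ⊎-map; map₂ to ⊎-map₂)
open import Data.Empty using (⊥-elim)
open import Relation.Nullary using (contradiction; yes; no)
open import Data.Vec using (Vec; []; _∷_)
open import Data.Vec.Relation.Unary.Any using (here; there) renaming (Any to Anyᵥ)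
open import Data.Vec.Membership.Propositional using (find) renaming (_∈_ to _∈ᵥ_)
open import Data.List using (List; []; _∷_; _++_; concatMap; upTo; length; cartesianProductWith)
import Data.List as List
open import Data.List.Relation.Unary.Any using (here; there; index; _─_)
import Data.List.Relation.Unary.Any as Any
open import Data.List.Membership.Propositional using (_∈_)
open import Data.List.Membership.Propositional.Properties
  using (∈-length; ∈-map⁺; ∈-++⁺ˡ; ∈-++⁺ʳ; ∈-concatMap⁺; ∈-cartesianProductWith⁺; ∈-upTo⁺)
open import Data.List.Membership.Setoid.Properties using (index-injective)
open import Data.List.Properties using (length-removeAt′; length-upTo)
open import Function using (_∘_; id; case_of_)
open import Function.Bundles using (_⇔_; mk⇔)
open import Relation.Nullary.Decidable using (decidable-stable)
open import Relation.Unary using (Pred)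
open import Relation.Binary using (Rel; tri<; tri≈; tri>)
open import Relation.Binary.PropositionalEquality
  using (_≡_; _≢_; refl; sym; trans; cong; cong₂; subst; setoid; module ≡-Reasoning)
open import Relation.Binary.Construct.Closure.ReflexiveTransitive using (Star; ε; _◅_; _◅◅_)
open import Relation.Binary.Construct.Closure.Transitive
  using (TransClosure; _∷_; _∷ʳ_) renaming ([_] to [_]⁺)

module _ {a} {A : Set a} where

  ∈-─⁺ : ∀ {x v} {xs : List A} (x∈xs : x ∈ xs) → v ∈ xs → v ≡ x ⊎ v ∈ (xs ─ x∈xs)
  ∈-─⁺ (here refl)  (here refl)  = inj₁ refl
  ∈-─⁺ (here _)     (there v∈xs) = inj₂ v∈xs
  ∈-─⁺ (there _)    (here refl)  = inj₂ (here refl)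
  ∈-─⁺ (there x∈xs) (there v∈xs) = ⊎-map₂ there (∈-─⁺ x∈xs v∈xs)

  pigeonhole-∈ : (u : ℕ → A) (xs : List A) → (∀ m → m ≤ length xs → u m ∈ xs) →
                 ∃₂ λ i j → i < j × u i ≡ u j
  pigeonhole-∈ u xs u∈xs =
    let i , j , i<j , same = pigeonhole (n<1+n (length xs)) (index ∘ u∈xs′)
    in toℕ i , toℕ j , i<j , index-injective (setoid A) (u∈xs′ i) (u∈xs′ j) same
    where
    u∈xs′ : (k : Fin (suc (length xs))) → u (toℕ k) ∈ xs
    u∈xs′ k = u∈xs (toℕ k) (s≤s⁻¹ (toℕ<n k))

all-below-or : ∀ {p b} {P : Pred ℕ p} {B : Set b} →
               (∀ m → P m ⊎ B) → ∀ n → (∀ m → m < n → P m) ⊎ B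
all-below-or P⊎B zero = inj₁ λ _ ()
all-below-or {P = P} P⊎B (suc n) with all-below-or P⊎B n | P⊎B n
... | inj₂ b     | _      = inj₂ b
... | inj₁ _     | inj₂ b = inj₂ b
... | inj₁ below | inj₁ Pn = inj₁ λ m m<1+n →
  [ below m , (λ m≡n → subst P (sym m≡n) Pn) ] (m<1+n⇒m<n∨m≡n m<1+n)

upper-bound-below : (h : ℕ → ℕ) (n : ℕ) → ∃ λ B → ∀ k → k < n → h k ≤ B
upper-bound-below h zero = 0 , λ _ ()
upper-bound-below h (suc n) with B , h≤B ← upper-bound-below h n =
  B ⊔ h n , λ k k<1+n →
    [ m≤n⇒m≤n⊔o (h n) ∘ h≤B k , (λ k≡n → subst (λ i → h i ≤ B ⊔ h n) (sym k≡n) (m≤n⊔m B (h n))) ]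
      (m<1+n⇒m<n∨m≡n k<1+n)

module _ {a} {A : Set a} (F : A → A) (u : ℕ → A) (u-step : ∀ n → u (suc n) ≡ F (u n)) where

  orbit-step : ∀ {n k} → u n ≡ u k → u (suc n) ≡ u (suc k)
  orbit-step {n} {k} un≡uk = begin
    u (suc n)  ≡⟨ u-step n ⟩
    F (u n)    ≡⟨ cong F un≡uk ⟩
    F (u k)    ≡⟨ u-step k ⟨
    u (suc k)  ∎
    where open ≡-Reasoning

  orbit-recurrent : ∀ {m m'} → m < m' → u m ≡ u m' → ∀ n → ∃ λ k → k < m' × u n ≡ u k
  orbit-recurrent m<m' loop zero = 0 , ≤-<-trans z≤n m<m' , refl
  orbit-recurrent {m} m<m' loop (suc n)
    with k , k<m' , un≡uk ← orbit-recurrent m<m' loop n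
    with m≤n⇒m<n∨m≡n k<m'
  ... | inj₁ 1+k<m' = suc k , 1+k<m' , orbit-step un≡uk
  ... | inj₂ 1+k≡m' = m , m<m' , trans (orbit-step un≡uk) (trans (cong u 1+k≡m') (sym loop))

  repeating-orbit-bounded : ∀ {m m'} → m < m' → u m ≡ u m' → (h : A → ℕ) → ∃ λ B → ∀ n → h (u n) ≤ B
  repeating-orbit-bounded {m' = m'} m<m' loop h with B , below ← upper-bound-below (h ∘ u) m' =
    B , λ n → let k , k<m' , un≡uk = orbit-recurrent m<m' loop n
              in subst (λ v → h v ≤ B) (sym un≡uk) (below k k<m')

  module _ (h : A → ℕ) (unbounded : ∀ D → ∃ λ n → D < h (u n)) where

    unbounded-orbit-no-repeat : ∀ {m m'} → m < m' → u m ≢ u m'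
    unbounded-orbit-no-repeat m<m' loop
      with B , bounded ← repeating-orbit-bounded m<m' loop h
      with n , B<h ← unbounded B
      = <⇒≱ B<h (bounded n)

    unbounded-orbit-injective : ∀ m m' → m ≢ m' → u m ≢ u m'
    unbounded-orbit-injective m m' m≢m' with <-cmp m m'
    ... | tri< m<m' _ _ = unbounded-orbit-no-repeat m<m'
    ... | tri≈ _ m≡m' _ = contradiction m≡m' m≢m'
    ... | tri> _ _ m'<m = unbounded-orbit-no-repeat m'<m ∘ sym

module _ {a ℓ p} {A : Set a} (E : Rel A ℓ) (P : Pred A p) where

  data Visits : A → ℕ → Set (a Level.⊔ ℓ Level.⊔ p) where
    pass  : ∀ {x y k} → E x y → Visits y k → Visits x k
    visit : ∀ {x y k} → P x → E x y → Visits y k → Visits x (suc k)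
    stop  : ∀ {x} → P x → Visits x 1

  -- Invariant: every P-node is still in the list, or it was visited and so reaches the current node.
  visits⇒cycle : ∀ {x k} (vs : List A) → (∀ {v} → P v → v ∈ vs ⊎ TransClosure E v x) →
                 length vs < k → Visits x k → ∃ λ v → TransClosure E v v × P v
  visits⇒cycle vs unvisited lt (pass e w) =
    visits⇒cycle vs (⊎-map₂ (_∷ʳ e) ∘ unvisited) lt w
  visits⇒cycle vs unvisited lt (visit {x} Px e w) with unvisited Px
  ... | inj₂ x⁺x = x , x⁺x , Px
  ... | inj₁ x∈vs = visits⇒cycle (vs ─ x∈vs) unvisited′ shorter w
    where
    shorter : length (vs ─ x∈vs) < _
    shorter = s<s⁻¹ (subst (_< _) (length-removeAt′ vs (index x∈vs)) lt)
    unvisited′ : ∀ {v} → P v → v ∈ (vs ─ x∈vs) ⊎ TransClosure E v _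
    unvisited′ Pv with unvisited Pv
    ... | inj₂ v⁺x = inj₂ (v⁺x ∷ʳ e)
    ... | inj₁ v∈vs = [ (λ { refl → inj₂ [ e ]⁺ }) , inj₁ ] (∈-─⁺ x∈vs v∈vs)
  visits⇒cycle vs unvisited lt (stop {x} Px) with unvisited Px
  ... | inj₂ x⁺x = x , x⁺x , Px
  ... | inj₁ x∈vs = ⊥-elim (<⇒≱ (∈-length x∈vs) (s≤s⁻¹ lt))

module _ {Σs : Signature} where

  infix 4 _∈ᵗ_

  _∈ᵗ_ : Var → Term Σs → Set
  x ∈ᵗ s = _∈V_ Σs x s

  _∙_ : Term Σs → Subst Σs → Term Σs
  s ∙ σ = _·_ Σs s σ

  _∙_^_ : Term Σs → Subst Σs → ℕ → Term Σs
  s ∙ σ ^ m = _·_^_ Σs s σ m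

  ∈ᵗ-var : ∀ {x y} → x ∈ᵗ var y → x ≡ y
  ∈ᵗ-var here = refl

  ∈ᵗ-arg : ∀ {x f} {ts : Vec (Term Σs) _} → Anyᵥ (x ∈ᵗ_) ts → x ∈ᵗ fun f ts
  ∈ᵗ-arg x∈ts = let _ , s∈ts , x∈s = find x∈ts in arg s∈ts x∈s

  ∙^-suc : ∀ s σ m → s ∙ σ ^ suc m ≡ (s ∙ σ) ∙ σ ^ m
  ∙^-suc s σ zero    = refl
  ∙^-suc s σ (suc m) = cong (_∙ σ) (∙^-suc s σ m)

  ∙^-+ : ∀ s σ a b → (s ∙ σ ^ a) ∙ σ ^ b ≡ s ∙ σ ^ (b + a)
  ∙^-+ s σ a zero    = refl
  ∙^-+ s σ a (suc b) = cong (_∙ σ) (∙^-+ s σ a b)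

  mutual
    _[_] : Term Σs → (Var → Term Σs) → Term Σs
    var x    [ τ ] = τ x
    fun f ts [ τ ] = fun f (ts [ τ ]ᵛ)

    _[_]ᵛ : ∀ {n} → Vec (Term Σs) n → (Var → Term Σs) → Vec (Term Σs) n
    []       [ τ ]ᵛ = []
    (s ∷ ts) [ τ ]ᵛ = s [ τ ] ∷ ts [ τ ]ᵛ

  mutual
    [var] : ∀ s → s [ var ] ≡ s
    [var] (var x)    = refl
    [var] (fun f ts) = cong (fun f) ([var]ᵛ ts)

    [var]ᵛ : ∀ {n} (ts : Vec (Term Σs) n) → ts [ var ]ᵛ ≡ ts
    [var]ᵛ []       = refl
    [var]ᵛ (s ∷ ts) = cong₂ _∷_ ([var] s) ([var]ᵛ ts)

  mutual
    [_]-∙ : ∀ τ σ s → (s [ τ ]) ∙ σ ≡ s [ (λ u → τ u ∙ σ) ]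
    [ τ ]-∙ σ (var x)    = refl
    [ τ ]-∙ σ (fun f ts) = cong (fun f) ([ τ ]ᵛ-∙ σ ts)

    [_]ᵛ-∙ : ∀ τ σ {n} (ts : Vec (Term Σs) n) → applyVec Σs (ts [ τ ]ᵛ) σ ≡ ts [ (λ u → τ u ∙ σ) ]ᵛ
    [ τ ]ᵛ-∙ σ []       = refl
    [ τ ]ᵛ-∙ σ (s ∷ ts) = cong₂ _∷_ ([ τ ]-∙ σ s) ([ τ ]ᵛ-∙ σ ts)

  ∙^≡[] : ∀ s σ m → s ∙ σ ^ m ≡ s [ (λ u → var u ∙ σ ^ m) ]
  ∙^≡[] s σ zero    = sym ([var] s)
  ∙^≡[] s σ (suc m) = trans (cong (_∙ σ) (∙^≡[] s σ m)) ([ _ ]-∙ σ s)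

  mutual
    instances : Term Σs → List (Term Σs) → List (Term Σs)
    instances (var _)    us = us
    instances (fun f ts) us = List.map (fun f) (instancesᵛ ts us)

    instancesᵛ : ∀ {n} → Vec (Term Σs) n → List (Term Σs) → List (Vec (Term Σs) n)
    instancesᵛ []       us = [] ∷ []
    instancesᵛ (s ∷ ts) us = cartesianProductWith _∷_ (instances s us) (instancesᵛ ts us)

  module _ {b} {B : Var → Set b} {τ : Var → Term Σs} {us : List (Term Σs)} where

    mutual
      ∈-instances-or : ∀ s → (∀ u → u ∈ᵗ s → τ u ∈ us ⊎ B u) →
                       s [ τ ] ∈ instances s us ⊎ ∃ λ u → u ∈ᵗ s × B u
      ∈-instances-or (var x) τ∈us = ⊎-map₂ (λ Bx → x , here , Bx) (τ∈us x here)
      ∈-instances-or (fun f ts) τ∈us =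
        ⊎-map (∈-map⁺ (fun f)) (λ (u , u∈ts , Bu) → u , ∈ᵗ-arg u∈ts , Bu)
              (∈-instancesᵛ-or ts (λ u → τ∈us u ∘ ∈ᵗ-arg))

      ∈-instancesᵛ-or : ∀ {n} (ts : Vec (Term Σs) n) → (∀ u → Anyᵥ (u ∈ᵗ_) ts → τ u ∈ us ⊎ B u) →
                        ts [ τ ]ᵛ ∈ instancesᵛ ts us ⊎ ∃ λ u → Anyᵥ (u ∈ᵗ_) ts × B u
      ∈-instancesᵛ-or [] _ = inj₁ (here refl)
      ∈-instancesᵛ-or (s ∷ ts) τ∈us
        with ∈-instances-or s (λ u → τ∈us u ∘ here) | ∈-instancesᵛ-or ts (λ u → τ∈us u ∘ there)
      ... | inj₂ (u , u∈s , Bu)  | _                     = inj₂ (u , here u∈s , Bu)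
      ... | inj₁ _               | inj₂ (u , u∈ts , Bu)  = inj₂ (u , there u∈ts , Bu)
      ... | inj₁ s[τ]∈           | inj₁ ts[τ]∈           =
        inj₁ (∈-cartesianProductWith⁺ _∷_ s[τ]∈ ts[τ]∈)

  mutual
    maxVar : Term Σs → ℕ
    maxVar (var x)    = x
    maxVar (fun f ts) = maxVarᵛ ts

    maxVarᵛ : ∀ {n} → Vec (Term Σs) n → ℕ
    maxVarᵛ []       = 0
    maxVarᵛ (s ∷ ts) = maxVar s ⊔ maxVarᵛ ts

  mutual
    depth : Term Σs → ℕ
    depth (var _)    = 0
    depth (fun f ts) = suc (depthᵛ ts)

    depthᵛ : ∀ {n} → Vec (Term Σs) n → ℕ
    depthᵛ []       = 0
    depthᵛ (s ∷ ts) = depth s ⊔ depthᵛ ts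

  ≤maxVarᵛ : ∀ {n s} {ts : Vec (Term Σs) n} → s ∈ᵥ ts → maxVar s ≤ maxVarᵛ ts
  ≤maxVarᵛ {ts = s ∷ ts} (here refl) = m≤m⊔n (maxVar s) (maxVarᵛ ts)
  ≤maxVarᵛ {ts = s ∷ ts} (there s∈ts) = m≤n⇒m≤o⊔n (maxVar s) (≤maxVarᵛ s∈ts)

  ∈ᵗ⇒≤maxVar : ∀ {x s} → x ∈ᵗ s → x ≤ maxVar s
  ∈ᵗ⇒≤maxVar here          = ≤-refl
  ∈ᵗ⇒≤maxVar (arg s∈ts x∈s) = ≤-trans (∈ᵗ⇒≤maxVar x∈s) (≤maxVarᵛ s∈ts)

  ≤depthᵛ : ∀ {n s} {ts : Vec (Term Σs) n} → s ∈ᵥ ts → depth s ≤ depthᵛ ts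
  ≤depthᵛ {ts = s ∷ ts} (here refl) = m≤m⊔n (depth s) (depthᵛ ts)
  ≤depthᵛ {ts = s ∷ ts} (there s∈ts) = m≤n⇒m≤o⊔n (depth s) (≤depthᵛ s∈ts)

  infix 4 _⊑_ _⊏_

  data _⊑_ : Term Σs → Term Σs → Set where
    ⊑-refl : ∀ {s} → s ⊑ s
    ⊑-arg  : ∀ {u s f ts} → s ∈ᵥ ts → u ⊑ s → u ⊑ fun f ts

  data _⊏_ : Term Σs → Term Σs → Set where
    ⊏-arg : ∀ {u s f ts} → s ∈ᵥ ts → u ⊑ s → u ⊏ fun f ts

  ⊑-trans : ∀ {u v w} → u ⊑ v → v ⊑ w → u ⊑ w
  ⊑-trans u⊑v ⊑-refl           = u⊑v
  ⊑-trans u⊑v (⊑-arg s∈ts v⊑s) = ⊑-arg s∈ts (⊑-trans u⊑v v⊑s)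

  ⊑-⊏-trans : ∀ {u v w} → u ⊑ v → v ⊏ w → u ⊏ w
  ⊑-⊏-trans u⊑v (⊏-arg s∈ts v⊑s) = ⊏-arg s∈ts (⊑-trans u⊑v v⊑s)

  var-⊑ : ∀ {x s} → x ∈ᵗ s → var x ⊑ s
  var-⊑ here           = ⊑-refl
  var-⊑ (arg s∈ts x∈s) = ⊑-arg s∈ts (var-⊑ x∈s)

  var-⊏ : ∀ {x s} → NotVar Σs s → x ∈ᵗ s → var x ⊏ s
  var-⊏ s≢var here           = ⊥-elim (s≢var _ refl)
  var-⊏ _     (arg s∈ts x∈s) = ⊏-arg s∈ts (var-⊑ x∈s)

  ⊑⇒depth≤ : ∀ {u s} → u ⊑ s → depth u ≤ depth s
  ⊑⇒depth≤ ⊑-refl           = ≤-refl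
  ⊑⇒depth≤ (⊑-arg s∈ts u⊑s) = m≤n⇒m≤1+n (≤-trans (⊑⇒depth≤ u⊑s) (≤depthᵛ s∈ts))

  ⊏⇒depth< : ∀ {u s} → u ⊏ s → depth u < depth s
  ⊏⇒depth< (⊏-arg s∈ts u⊑s) = s≤s (≤-trans (⊑⇒depth≤ u⊑s) (≤depthᵛ s∈ts))

  module _ (σ : Subst Σs) where

    ∈ᵥ-∙ : ∀ {n s} {ts : Vec (Term Σs) n} → s ∈ᵥ ts → s ∙ σ ∈ᵥ applyVec Σs ts σ
    ∈ᵥ-∙ (here refl)  = here refl
    ∈ᵥ-∙ (there s∈ts) = there (∈ᵥ-∙ s∈ts)

    ∙-mono-⊑ : ∀ {u s} → u ⊑ s → u ∙ σ ⊑ s ∙ σ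
    ∙-mono-⊑ ⊑-refl           = ⊑-refl
    ∙-mono-⊑ (⊑-arg s∈ts u⊑s) = ⊑-arg (∈ᵥ-∙ s∈ts) (∙-mono-⊑ u⊑s)

    ∙-mono-⊏ : ∀ {u s} → u ⊏ s → u ∙ σ ⊏ s ∙ σ
    ∙-mono-⊏ (⊏-arg s∈ts u⊑s) = ⊏-arg (∈ᵥ-∙ s∈ts) (∙-mono-⊑ u⊑s)

    ∙^-mono-⊑ : ∀ m {u s} → u ⊑ s → u ∙ σ ^ m ⊑ s ∙ σ ^ m
    ∙^-mono-⊑ zero    = id
    ∙^-mono-⊑ (suc m) = ∙-mono-⊑ ∘ ∙^-mono-⊑ m

    ∙^-mono-⊏ : ∀ m {u s} → u ⊏ s → u ∙ σ ^ m ⊏ s ∙ σ ^ m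
    ∙^-mono-⊏ zero    = id
    ∙^-mono-⊏ (suc m) = ∙-mono-⊏ ∘ ∙^-mono-⊏ m

    depth-grows : ∀ {s L} → s ⊏ s ∙ σ ^ L → ∀ j → j ≤ depth (s ∙ σ ^ (j * L))
    depth-grows s⊏ zero = z≤n
    depth-grows {s} {L} s⊏ (suc j) = <-≤-trans (s≤s (depth-grows s⊏ j)) (⊏⇒depth< next)
      where
      next : s ∙ σ ^ (j * L) ⊏ s ∙ σ ^ (L + j * L)
      next = subst (s ∙ σ ^ (j * L) ⊏_)
                   (trans (∙^-+ s σ L (j * L)) (cong (s ∙ σ ^_) (+-comm (j * L) L)))
                   (∙^-mono-⊏ (j * L) s⊏)

module _ {Σs : Signature} (t : Term Σs) (σ : Subst Σs) where

  private
    _⟶_ : Var → Var → Set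
    _⟶_ = Edge Σs σ

    _⟶ᴳ_ : Var → Var → Set
    _⟶ᴳ_ = EdgeG Σs σ t

    InGraph : Var → Set
    InGraph = InG Σs σ t

  Grows : Var → Set
  Grows x = NotVar Σs (Subst.map σ x)

  GrowingCycle : Set
  GrowingCycle = ∃ λ x → OnCycle Σs σ t x × Grows x

  edge-⊑ : ∀ {a c} n → a ⟶ c → var c ∙ σ ^ n ⊑ var a ∙ σ ^ suc n
  edge-⊑ {a} {c} n a⟶c =
    subst (var c ∙ σ ^ n ⊑_) (sym (∙^-suc (var a) σ n)) (∙^-mono-⊑ σ n (var-⊑ a⟶c))

  growing-edge-⊏ : ∀ {a c} n → Grows a → a ⟶ c → var c ∙ σ ^ n ⊏ var a ∙ σ ^ suc n
  growing-edge-⊏ {a} {c} n a-grows a⟶c =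
    subst (var c ∙ σ ^ n ⊏_) (sym (∙^-suc (var a) σ n)) (∙^-mono-⊏ σ n (var-⊏ a-grows a⟶c))

  path-⊑ : ∀ {a b} → Star _⟶_ a b → ∃ λ n → var b ⊑ var a ∙ σ ^ n
  path-⊑ ε = 0 , ⊑-refl
  path-⊑ (a⟶c ◅ c⋆b) =
    let n , b⊑ = path-⊑ c⋆b
    in suc n , ⊑-trans b⊑ (edge-⊑ n a⟶c)

  ⁺-source : ∀ {a b} → TransClosure _⟶ᴳ_ a b → InGraph a
  ⁺-source [ a∈G , _ ]⁺     = a∈G
  ⁺-source ((a∈G , _) ∷ _) = a∈G

  ⁺-uncons : ∀ {a b} → TransClosure _⟶ᴳ_ a b → ∃ λ c → a ⟶ c × Star _⟶_ c b
  ⁺-uncons [ _ , _ , a⟶b ]⁺     = _ , a⟶b , ε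
  ⁺-uncons ((_ , _ , a⟶c) ∷ c⁺b) = let d , c⟶d , d⋆b = ⁺-uncons c⁺b in _ , a⟶c , c⟶d ◅ d⋆b

  growing-cycle-⊏ : ∀ {x} → OnCycle Σs σ t x → Grows x → ∃ λ L → var x ⊏ var x ∙ σ ^ L
  growing-cycle-⊏ x⁺x x-grows =
    let c , x⟶c , c⋆x = ⁺-uncons x⁺x
        n , x⊑ = path-⊑ c⋆x
    in suc n , ⊑-⊏-trans x⊑ (growing-edge-⊏ n x-grows x⟶c)

  depth-unbounded : GrowingCycle → ∀ D → ∃ λ n → D < depth (t ∙ σ ^ n)
  depth-unbounded (x , x⁺x , x-grows) D =
    let L , x⊏ = growing-cycle-⊏ x⁺x x-grows
        z , z∈t , z⋆x = ⁺-source x⁺x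
        d , x⊑ = path-⊑ z⋆x
        n = suc D * L
        x⊑t : var x ∙ σ ^ n ⊑ t ∙ σ ^ (n + d)
        x⊑t = subst (var x ∙ σ ^ n ⊑_) (∙^-+ t σ d n)
                (∙^-mono-⊑ σ n (⊑-trans x⊑ (∙^-mono-⊑ σ d (var-⊑ z∈t))))
    in n + d , <-≤-trans (depth-grows σ {L = L} x⊏ (suc D)) (⊑⇒depth≤ x⊑t)

  growing-cycle⇒pattern : GrowingCycle → IsPatternTerm Σs t σ
  growing-cycle⇒pattern cycle =
    unbounded-orbit-injective (_∙ σ) (t ∙ σ ^_) (λ _ → refl) depth (depth-unbounded cycle)

  N : ℕ
  N = proj₁ (Subst.finite σ)

  fixed-beyond-N : ∀ {x} → x ≮ N → Subst.map σ x ≡ var x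
  fixed-beyond-N {x} x≮N = proj₂ (Subst.finite σ) x (≮⇒≥ x≮N)

  growing⇒<N : ∀ {x} → Grows x → x < N
  growing⇒<N {x} x-grows = decidable-stable (x <? N) λ x≮N → x-grows x (fixed-beyond-N x≮N)

  image-bound : ∃ λ B → ∀ y → y < N → maxVar (Subst.map σ y) ≤ B
  image-bound = upper-bound-below (maxVar ∘ Subst.map σ) N

  Bound : ℕ
  Bound = maxVar t ⊔ proj₁ image-bound

  edge-bounded : ∀ {a b} → a ⟶ b → a ≤ Bound → b ≤ Bound
  edge-bounded {a} a⟶b a≤ with a <? N
  ... | yes a<N = ≤-trans (∈ᵗ⇒≤maxVar a⟶b) (m≤n⇒m≤o⊔n (maxVar t) (proj₂ image-bound a a<N))
  ... | no a≮N  = subst (_≤ Bound) (sym (∈ᵗ-var (subst (_ ∈ᵗ_) (fixed-beyond-N a≮N) a⟶b))) a≤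

  path-bounded : ∀ {a b} → Star _⟶_ a b → a ≤ Bound → b ≤ Bound
  path-bounded ε           = id
  path-bounded (a⟶c ◅ c⋆b) = path-bounded c⋆b ∘ edge-bounded a⟶c

  in-graph-bounded : ∀ {x} → InGraph x → x ≤ Bound
  in-graph-bounded (z , z∈t , z⋆x) = path-bounded z⋆x (m≤n⇒m≤n⊔o _ (∈ᵗ⇒≤maxVar z∈t))

  mutual
    Candidates : ℕ → List (Term Σs)
    Candidates zero    = List.map var (upTo (suc Bound))
    Candidates (suc r) = Candidates r ++ concatMap (image-instances r) (upTo N)

    image-instances : ℕ → Var → List (Term Σs)
    image-instances r y = instances (Subst.map σ y) (Candidates r)

  var∈Candidates : ∀ r {x} → x ≤ Bound → var x ∈ Candidates r
  var∈Candidates zero    x≤ = ∈-map⁺ var (∈-upTo⁺ (s≤s x≤))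
  var∈Candidates (suc r) x≤ = ∈-++⁺ˡ (var∈Candidates r x≤)

  instance∈Candidates : ∀ r {x s s'} → Grows x → Subst.map σ x ≡ s' →
                        s ∈ instances s' (Candidates r) → s ∈ Candidates (suc r)
  instance∈Candidates r x-grows refl s∈ =
    ∈-++⁺ʳ (Candidates r)
           (∈-concatMap⁺ (image-instances r) (Any.map (λ { refl → s∈ }) (∈-upTo⁺ (growing⇒<N x-grows))))

  private
    Walk : Var → ℕ → Set
    Walk = Visits _⟶ᴳ_ Grows

  edge-into : ∀ {x u s} → InGraph x → Subst.map σ x ≡ s → u ∈ᵗ s → x ⟶ᴳ u
  edge-into x∈G refl x⟶u = x∈G , in-graph-step x∈G x⟶u , x⟶u
    where
    in-graph-step : ∀ {x u} → InGraph x → x ⟶ u → InGraph u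
    in-graph-step (z , z∈t , z⋆x) x⟶u = z , z∈t , z⋆x ◅◅ (x⟶u ◅ ε)

  fun-image-grows : ∀ {x f ts} → Subst.map σ x ≡ fun f ts → Grows x
  fun-image-grows σx≡fun y σx≡var = case trans (sym σx≡fun) σx≡var of λ ()

  -- Either x σ^m is assembled within r rounds, or following a variable whose orbit escapes
  -- the candidates yields a walk through r + 1 growing variables.
  mutual
    var-orbit : ∀ r m {x} → InGraph x → var x ∙ σ ^ m ∈ Candidates r ⊎ Walk x (suc r)
    var-orbit r zero    x∈G = inj₁ (var∈Candidates r (in-graph-bounded x∈G))
    var-orbit r (suc m) {x} x∈G =
      subst (λ s → s ∈ Candidates r ⊎ Walk x (suc r)) (sym (∙^-suc (var x) σ m))
            (image-orbit r m x∈G _ refl)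

    image-orbit : ∀ r m {x} → InGraph x → ∀ s → Subst.map σ x ≡ s →
                  s ∙ σ ^ m ∈ Candidates r ⊎ Walk x (suc r)
    image-orbit r m x∈G (var y) σx≡y =
      let x⟶y = edge-into x∈G σx≡y here
      in ⊎-map₂ (pass x⟶y) (var-orbit r m (proj₁ (proj₂ x⟶y)))
    image-orbit zero m x∈G (fun f ts) σx≡fun = inj₂ (stop (fun-image-grows σx≡fun))
    image-orbit (suc r) m x∈G (fun f ts) σx≡fun =
      ⊎-map (instance∈Candidates r (fun-image-grows σx≡fun) σx≡fun)
            (λ (u , u∈σx , w) → visit (fun-image-grows σx≡fun) (edge-into x∈G σx≡fun u∈σx) w)
            (term-orbit r m (fun f ts) (proj₁ ∘ proj₂ ∘ edge-into x∈G σx≡fun))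

    term-orbit : ∀ r m s → (∀ {u} → u ∈ᵗ s → InGraph u) →
                 s ∙ σ ^ m ∈ instances s (Candidates r) ⊎ ∃ λ u → u ∈ᵗ s × Walk u (suc r)
    term-orbit r m s vars∈G =
      subst (λ s′ → s′ ∈ instances s (Candidates r) ⊎ _) (sym (∙^≡[] s σ m))
            (∈-instances-or s (λ u u∈s → var-orbit r m (vars∈G u∈s)))

  orbit-∈-or-cycle : ∀ m → t ∙ σ ^ m ∈ instances t (Candidates N) ⊎ GrowingCycle
  orbit-∈-or-cycle m = ⊎-map₂ cycle (term-orbit N m t (λ u∈t → _ , u∈t , ε))
    where
    cycle : (∃ λ u → u ∈ᵗ t × Walk u (suc N)) → GrowingCycle
    cycle (u , _ , w) = visits⇒cycle _⟶ᴳ_ Grows (upTo N) (inj₁ ∘ ∈-upTo⁺ ∘ growing⇒<N)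
                                     (s≤s (≤-reflexive (length-upTo N))) w

  pattern⇒growing-cycle : IsPatternTerm Σs t σ → GrowingCycle
  pattern⇒growing-cycle injective
    with all-below-or orbit-∈-or-cycle (suc (length (instances t (Candidates N))))
  ... | inj₂ cycle = cycle
  ... | inj₁ all∈ =
    let i , j , i<j , same = pigeonhole-∈ (t ∙ σ ^_) _ (λ m → all∈ m ∘ s≤s)
    in ⊥-elim (injective i j (<⇒≢ i<j) same)

lemma21 : (Σs : Signature) (t : Term Σs) (σ : Subst Σs) →
            IsPatternTerm Σs t σ ⇔
              (∃ λ x → OnCycle Σs σ t x × NotVar Σs (Subst.map σ x))
lemma21 Σs t σ = mk⇔ (pattern⇒growing-cycle t σ) (growing-cycle⇒pattern t σ)
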